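{- Let $D=(d_{i,j})$ be a $2\times n$ tree degree matrix in which the second row is a path degree sequence, and suppose $n\ge 6$. Let $f_1\ge f_2\ge\dots\ge f_n$ be the column sums $d_{1,j}+d_{2,j}$ arranged in non-increasing order. Then for every $s$ with $2\le s\le n$, $$\sum_{i=1}^s f_i\le s(s-1)+\sum_{j=s+1}^n\min\{s,f_j\}.$$
   Context: A tree degree sequence $d_1,\dots,d_n$ is a sequence of positive integers with $\sum_j d_j=2n-2$; it is a path degree sequence if it has exactly two entries equal to $1$. A tree degree matrix is a matrix each of whose rows is a tree degree sequence. -}

module Defs where

open import Data.Nat using (ℕ; zero; suc; _+_; _*_; _≤_; _<_; _≥_; _⊓_)
open import Data.Fin using (Fin; toℕ) renaming (zero to fz; suc to fs)
open import Data.Product using (_×_)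
open import Relation.Binary.PropositionalEquality using (_≡_)

sumFin : (n : ℕ) → (Fin n → ℕ) → ℕ
sumFin zero    f = 0
sumFin (suc n) f = f fz + sumFin n (λ i → f (fs i))

AllPositive : {n : ℕ} → (Fin n → ℕ) → Set
AllPositive {n} d = (j : Fin n) → 1 ≤ d j

-- tree degree sequence: positive integers with sum 2n - 2  (stated as sum + 2 = 2n)
IsTreeDegSeq : (n : ℕ) → (Fin n → ℕ) → Set
IsTreeDegSeq n d = AllPositive d × (sumFin n d + 2 ≡ 2 * n)

countOnes : (n : ℕ) → (Fin n → ℕ) → ℕ
countOnes n d = sumFin n (λ j → one? (d j))
  where
  one? : ℕ → ℕ
  one? (suc zero) = 1
  one? _          = 0

IsPathDegSeq : (n : ℕ) → (Fin n → ℕ) → Set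
IsPathDegSeq n d = IsTreeDegSeq n d × (countOnes n d ≡ 2)

IsTreeDegMatrix : (m n : ℕ) → (Fin m → Fin n → ℕ) → Set
IsTreeDegMatrix m n D = (i : Fin m) → IsTreeDegSeq n (D i)

NonIncreasing : {n : ℕ} → (Fin n → ℕ) → Set
NonIncreasing {n} f = (i j : Fin n) → toℕ i ≤ toℕ j → f j ≤ f i

if< : ℕ → ℕ → ℕ → ℕ → ℕ
if< zero    zero    x y = y
if< zero    (suc b) x y = x
if< (suc a) zero    x y = y
if< (suc a) (suc b) x y = if< a b x y

module Submission where

-- Write a, b for the two rows and e = [b = 1]. Since a path degree sequence has entries at most 2,
-- every column has a + b ≤ 2 + a; and for s ≥ 3 every column has 4 ≤ min(s, a + b) + a + e.
-- Adding the first bound over the s leading columns and the second over the n - s others, with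
-- Σ a = 2n - 2 and Σ e = 2, gives  Σ_{i≤s} f_i ≤ Σ_{j>s} min(s, f_j) + 6s - 2n, and
-- s(s - 1) - (6s - 2n) ≥ (s - 3)(s - 4) ≥ 0 as n ≥ 6. For s = 2 the bound 3 ≤ min(2, a + b) + a
-- (without e) leaves 8 - n ≤ 2.

open import Defs
open import Data.Nat using (ℕ; zero; suc; _+_; _*_; _∸_; _≤_; _⊓_; z≤n; s≤s)
open import Data.Fin using (Fin; toℕ; zero; suc)
open import Function.Bundles using (_↔_; Inverse)
open import Data.Nat.Properties
open import Data.Nat.Tactic.RingSolver using (solve-∀)
open import Data.Product using (_,_)
open import Data.Sum using (_⊎_; inj₁; inj₂)
open import Relation.Binary.PropositionalEquality
  using (_≡_; refl; sym; trans; cong; cong₂; module ≡-Reasoning)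
import Algebra.Properties.CommutativeMonoid.Sum as MonoidSum

sumFin-cong : ∀ n {f g : Fin n → ℕ} → (∀ k → f k ≡ g k) → sumFin n f ≡ sumFin n g
sumFin-cong zero    f≗g = refl
sumFin-cong (suc n) f≗g = cong₂ _+_ (f≗g zero) (sumFin-cong n (λ k → f≗g (suc k)))

sumFin-mono-≤ : ∀ n {f g : Fin n → ℕ} → (∀ k → f k ≤ g k) → sumFin n f ≤ sumFin n g
sumFin-mono-≤ zero    f≤g = z≤n
sumFin-mono-≤ (suc n) f≤g = +-mono-≤ (f≤g zero) (sumFin-mono-≤ n (λ k → f≤g (suc k)))

sumFin-+ : ∀ n (f g : Fin n → ℕ) → sumFin n (λ k → f k + g k) ≡ sumFin n f + sumFin n g
sumFin-+ zero    f g = refl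
sumFin-+ (suc n) f g = trans (cong (f zero + g zero +_) (sumFin-+ n _ _))
  (+-interchange (f zero) (g zero) _ _)
  where
  +-interchange : ∀ a b c d → a + b + (c + d) ≡ a + c + (b + d)
  +-interchange = solve-∀

sumFin-const : ∀ n c → sumFin n (λ _ → c) ≡ n * c
sumFin-const zero    c = refl
sumFin-const (suc n) c = cong (c +_) (sumFin-const n c)

sumFin-≤-≡⇒≡ : ∀ n {f g : Fin n → ℕ} → (∀ k → g k ≤ f k) → sumFin n f ≡ sumFin n g →
  ∀ k → f k ≡ g k
sumFin-≤-≡⇒≡ (suc n) {f} {g} g≤f Σf≡Σg zero =
  ≤-antisym (+-cancelʳ-≤ (sumFin n (λ k → f (suc k))) _ _ (begin
    f zero + sumFin n (λ k → f (suc k)) ≡⟨ Σf≡Σg ⟩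
    g zero + sumFin n (λ k → g (suc k)) ≤⟨ +-monoʳ-≤ (g zero) (sumFin-mono-≤ n (λ k → g≤f (suc k))) ⟩
    g zero + sumFin n (λ k → f (suc k)) ∎)) (g≤f zero)
  where open ≤-Reasoning
sumFin-≤-≡⇒≡ (suc n) {f} {g} g≤f Σf≡Σg (suc k) =
  sumFin-≤-≡⇒≡ n (λ k → g≤f (suc k))
    (+-cancelˡ-≡ (f zero) _ _ (trans Σf≡Σg (cong (_+ _) (sym (sumFin-≤-≡⇒≡ (suc n) g≤f Σf≡Σg zero)))))
    k

sumFin-permute : ∀ n (σ : Fin n ↔ Fin n) (f : Fin n → ℕ) →
  sumFin n (λ k → f (Inverse.to σ k)) ≡ sumFin n f
sumFin-permute n σ f =
  trans (sym (sumFin≡sum (λ k → f (Inverse.to σ k)))) (trans (sym (sum-permute f σ)) (sumFin≡sum f))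
  where
  open MonoidSum +-0-commutativeMonoid using (sum; sum-permute)
  sumFin≡sum : ∀ {m} (g : Fin m → ℕ) → sum g ≡ sumFin m g
  sumFin≡sum {zero}  g = refl
  sumFin≡sum {suc m} g = cong (g zero +_) (sumFin≡sum (λ i → g (suc i)))

if<-cases : ∀ i s → (∀ (x y : ℕ) → if< i s x y ≡ x) ⊎ (∀ (x y : ℕ) → if< i s x y ≡ y)
if<-cases zero    zero    = inj₂ (λ _ _ → refl)
if<-cases zero    (suc s) = inj₁ (λ _ _ → refl)
if<-cases (suc i) zero    = inj₂ (λ _ _ → refl)
if<-cases (suc i) (suc s) = if<-cases i s

if<-mono-≤ : ∀ i s {x x′ y y′} → x ≤ x′ → y ≤ y′ → if< i s x y ≤ if< i s x′ y′
if<-mono-≤ i s {x} {x′} {y} {y′} x≤x′ y≤y′ with if<-cases i s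
... | inj₁ e rewrite e x y | e x′ y′ = x≤x′
... | inj₂ e rewrite e x y | e x′ y′ = y≤y′

if<-+ʳ : ∀ i s x y z → if< i s (x + z) (y + z) ≡ if< i s x y + z
if<-+ʳ i s x y z with if<-cases i s
... | inj₁ e rewrite e (x + z) (y + z) | e x y = refl
... | inj₂ e rewrite e (x + z) (y + z) | e x y = refl

if<-split : ∀ i s x y → if< i s x y ≡ if< i s x 0 + if< i s 0 y
if<-split i s x y with if<-cases i s
... | inj₁ e rewrite e x y | e x 0 | e 0 y = sym (+-identityʳ x)
... | inj₂ e rewrite e x y | e x 0 | e 0 y = refl

sumFin-if<-split : ∀ n s (x y : Fin n → ℕ) →
  sumFin n (λ k → if< (toℕ k) s (x k) (y k))
    ≡ sumFin n (λ k → if< (toℕ k) s (x k) 0) + sumFin n (λ k → if< (toℕ k) s 0 (y k))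
sumFin-if<-split n s x y =
  trans (sumFin-cong n (λ k → if<-split (toℕ k) s (x k) (y k))) (sumFin-+ n _ _)

sumFin-if<-const : ∀ n s x y → s ≤ n → sumFin n (λ k → if< (toℕ k) s x y) ≡ s * x + (n ∸ s) * y
sumFin-if<-const n       zero    x y _ =
  trans (sumFin-cong n (λ k → if<-zero (toℕ k))) (sumFin-const n y)
  where
  if<-zero : ∀ i → if< i 0 x y ≡ y
  if<-zero zero    = refl
  if<-zero (suc i) = refl
sumFin-if<-const (suc n) (suc s) x y (s≤s s≤n) =
  trans (cong (x +_) (sumFin-if<-const n s x y s≤n)) (sym (+-assoc x (s * x) _))

isOne : ℕ → ℕ
isOne 1 = 1
isOne _ = 0

countOnes-isOne : ∀ n (d : Fin n → ℕ) → countOnes n d ≡ sumFin n (λ j → isOne (d j))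
countOnes-isOne zero    d = refl
countOnes-isOne (suc n) d with d zero | countOnes-isOne n (λ j → d (suc j))
... | 0           | ih = ih
... | 1           | ih = cong suc ih
... | suc (suc _) | ih = ih

IsTreeDegSeq-permute : ∀ n (σ : Fin n ↔ Fin n) {d : Fin n → ℕ} →
  IsTreeDegSeq n d → IsTreeDegSeq n (λ k → d (Inverse.to σ k))
IsTreeDegSeq-permute n σ {d} (pos , Σd) =
  (λ k → pos (Inverse.to σ k)) , trans (cong (_+ 2) (sumFin-permute n σ d)) Σd

IsPathDegSeq-permute : ∀ n (σ : Fin n ↔ Fin n) {d : Fin n → ℕ} →
  IsPathDegSeq n d → IsPathDegSeq n (λ k → d (Inverse.to σ k))
IsPathDegSeq-permute n σ {d} (tree , ones) = IsTreeDegSeq-permute n σ tree , (begin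
  countOnes n (λ k → d (Inverse.to σ k))       ≡⟨ countOnes-isOne n _ ⟩
  sumFin n (λ k → isOne (d (Inverse.to σ k)))  ≡⟨ sumFin-permute n σ (λ j → isOne (d j)) ⟩
  sumFin n (λ j → isOne (d j))                 ≡⟨ countOnes-isOne n d ⟨
  countOnes n d                                ≡⟨ ones ⟩
  2                                            ∎)
  where open ≡-Reasoning

-- Σ (d j + [d j = 1]) = (2n - 2) + 2 = Σ 2 while every term is at least 2, so every term is exactly 2.
IsPathDegSeq⇒≤2 : ∀ n {d : Fin n → ℕ} → IsPathDegSeq n d → ∀ j → d j ≤ 2
IsPathDegSeq⇒≤2 n {d} ((pos , Σd) , ones) j =
  ≤-trans (m≤m+n (d j) (isOne (d j))) (≤-reflexive (sumFin-≤-≡⇒≡ n 2≤ Σ≡ j))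
  where
  2≤ : ∀ j → 2 ≤ d j + isOne (d j)
  2≤ j with d j | pos j
  ... | 1           | _ = ≤-refl
  ... | suc (suc _) | _ = s≤s (s≤s z≤n)
  Σ≡ : sumFin n (λ j → d j + isOne (d j)) ≡ sumFin n (λ _ → 2)
  Σ≡ = begin
    sumFin n (λ j → d j + isOne (d j))            ≡⟨ sumFin-+ n d _ ⟩
    sumFin n d + sumFin n (λ j → isOne (d j))     ≡⟨ cong (sumFin n d +_) (trans (sym (countOnes-isOne n d)) ones) ⟩
    sumFin n d + 2                                ≡⟨ Σd ⟩
    2 * n                                         ≡⟨ *-comm 2 n ⟩
    n * 2                                         ≡⟨ sumFin-const n 2 ⟨
    sumFin n (λ _ → 2)                            ∎
    where open ≡-Reasoning

sumFin-head+tail≤ : ∀ n s h c (S m w : Fin n → ℕ) → s ≤ n →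
  (∀ k → S k ≤ h + w k) → (∀ k → c ≤ m k + w k) →
  sumFin n (λ k → if< (toℕ k) s (S k) 0) + (n ∸ s) * c
    ≤ sumFin n (λ k → if< (toℕ k) s 0 (m k)) + (s * h + sumFin n w)
sumFin-head+tail≤ n s h c S m w s≤n head tail = begin
  Head + (n ∸ s) * c                              ≡⟨ cong (Head +_) tail-const ⟨
  Head + sumFin n (λ k → if< (toℕ k) s 0 c)       ≡⟨ sumFin-if<-split n s S (λ _ → c) ⟨
  sumFin n (λ k → if< (toℕ k) s (S k) c)          ≤⟨ sumFin-mono-≤ n (λ k → if<-mono-≤ (toℕ k) s (head k) (tail k)) ⟩
  sumFin n (λ k → if< (toℕ k) s (h + w k) (m k + w k))
    ≡⟨ sumFin-cong n (λ k → if<-+ʳ (toℕ k) s h (m k) (w k)) ⟩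
  sumFin n (λ k → if< (toℕ k) s h (m k) + w k)    ≡⟨ sumFin-+ n _ w ⟩
  sumFin n (λ k → if< (toℕ k) s h (m k)) + Σw     ≡⟨ cong (_+ Σw) (sumFin-if<-split n s (λ _ → h) m) ⟩
  sumFin n (λ k → if< (toℕ k) s h 0) + Tail + Σw  ≡⟨ cong (λ x → x + Tail + Σw) head-const ⟩
  s * h + Tail + Σw                               ≡⟨ cong (_+ Σw) (+-comm (s * h) Tail) ⟩
  Tail + s * h + Σw                               ≡⟨ +-assoc Tail (s * h) Σw ⟩
  Tail + (s * h + Σw)                             ∎
  where
  open ≤-Reasoning
  Head Tail Σw : ℕ
  Head = sumFin n (λ k → if< (toℕ k) s (S k) 0)
  Tail = sumFin n (λ k → if< (toℕ k) s 0 (m k))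
  Σw   = sumFin n w
  tail-const : sumFin n (λ k → if< (toℕ k) s 0 c) ≡ (n ∸ s) * c
  tail-const = trans (sumFin-if<-const n s 0 c s≤n) (cong (_+ (n ∸ s) * c) (*-zeroʳ s))
  head-const : sumFin n (λ k → if< (toℕ k) s h 0) ≡ s * h
  head-const = trans (sumFin-if<-const n s h 0 s≤n)
    (trans (cong (s * h +_) (*-zeroʳ (n ∸ s))) (+-identityʳ (s * h)))

column≤2+ : ∀ {a b} → b ≤ 2 → a + b ≤ 2 + a
column≤2+ {a} b≤2 = ≤-trans (+-monoʳ-≤ a b≤2) (≤-reflexive (+-comm a 2))

-- The leaf indicator pays for the one column shape, a = b = 1, whose capped sum is only 2.
4≤capped-column : ∀ {s a b} → 3 ≤ s → 1 ≤ a → 1 ≤ b → 4 ≤ s ⊓ (a + b) + (a + isOne b)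
4≤capped-column {s} {1} {1} 3≤s _ _ = ≤-reflexive (cong (_+ 2) (sym (m≥n⇒m⊓n≡n (≤-trans (n≤1+n 2) 3≤s))))
4≤capped-column {s} {1} {suc (suc b)} 3≤s _ _ =
  ≤-trans (+-monoˡ-≤ 1 (⊓-glb 3≤s (s≤s (s≤s (s≤s z≤n))))) (+-monoʳ-≤ (s ⊓ _) (m≤m+n 1 _))
4≤capped-column {s} {suc (suc a)} {suc b} 3≤s _ _ =
  ≤-trans (+-mono-≤ (⊓-glb 3≤s (s≤s (s≤s (m≤n⇒m≤o+n a (s≤s z≤n))))) (s≤s z≤n))
    (+-monoʳ-≤ (s ⊓ _) (m≤m+n (suc (suc a)) _))

3≤2-capped-column : ∀ {a b} → 1 ≤ a → 1 ≤ b → 3 ≤ 2 ⊓ (a + b) + a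
3≤2-capped-column a≥1 b≥1 = +-mono-≤ (⊓-glb ≤-refl (+-mono-≤ a≥1 b≥1)) a≥1

≤-slack : ∀ x k {y} → x + k ≡ y → x ≤ y
≤-slack x k x+k≡y = ≤-trans (m≤m+n x k) (≤-reflexive x+k≡y)

budget≥3 : ∀ s n → 3 ≤ s → s ≤ n → 6 ≤ n → s * 2 + 2 * n ≤ s * (s ∸ 1) + (n ∸ s) * 4
budget≥3 s n 3≤s s≤n 6≤n with m≤n⇒∃[o]m+o≡n s≤n
... | m , refl rewrite m+n∸m≡n s m = budget s m 3≤s 6≤n
  where
  budget : ∀ s m → 3 ≤ s → 6 ≤ s + m → s * 2 + 2 * (s + m) ≤ s * (s ∸ 1) + m * 4
  budget 1 _ (s≤s ()) _
  budget 2 _ (s≤s (s≤s ())) _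
  budget 3 m _ 6≤3+m with m≤n⇒∃[o]m+o≡n (+-cancelˡ-≤ 3 3 m 6≤3+m)
  ... | m′ , refl = ≤-slack _ (2 * m′) (identity m′)
    where
    identity : ∀ m′ → 3 * 2 + 2 * (3 + (3 + m′)) + 2 * m′ ≡ 3 * 2 + (3 + m′) * 4
    identity = solve-∀
  budget 4 m _ 6≤4+m with m≤n⇒∃[o]m+o≡n (+-cancelˡ-≤ 4 2 m 6≤4+m)
  ... | m′ , refl = ≤-slack _ (2 * m′) (identity m′)
    where
    identity : ∀ m′ → 4 * 2 + 2 * (4 + (2 + m′)) + 2 * m′ ≡ 4 * 3 + (2 + m′) * 4
    identity = solve-∀
  budget (suc (suc (suc (suc (suc t))))) m _ _ = ≤-slack _ (5 * t + t * t + 2 * m) (identity t m)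
    where
    identity : ∀ t m → (5 + t) * 2 + 2 * (5 + t + m) + (5 * t + t * t + 2 * m) ≡ (5 + t) * (4 + t) + m * 4
    identity = solve-∀

budget2 : ∀ n A → 6 ≤ n → A + 2 ≡ 2 * n → 2 * 2 + A ≤ 2 * (2 ∸ 1) + (n ∸ 2) * 3
budget2 n A 6≤n A+2≡2n with m≤n⇒∃[o]m+o≡n 6≤n
... | m , refl = ≤-slack _ m (trans (cong (λ x → 2 * 2 + x + m) A≡10+2m) (identity₂ m))
  where
  identity₁ : ∀ m → 2 * (6 + m) ≡ 10 + 2 * m + 2
  identity₁ = solve-∀
  identity₂ : ∀ m → 2 * 2 + (10 + 2 * m) + m ≡ 2 * 1 + (4 + m) * 3
  identity₂ = solve-∀
  A≡10+2m : A ≡ 10 + 2 * m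
  A≡10+2m = +-cancelʳ-≡ 2 A (10 + 2 * m) (trans A+2≡2n (identity₁ m))

≤-budget : ∀ {H X T Y Z} → H + X ≤ T + Y → Y ≤ Z + X → H ≤ Z + T
≤-budget {H} {X} {T} {Y} {Z} H+X≤T+Y Y≤Z+X = +-cancelʳ-≤ X H (Z + T) (begin
  H + X        ≤⟨ H+X≤T+Y ⟩
  T + Y        ≤⟨ +-monoʳ-≤ T Y≤Z+X ⟩
  T + (Z + X)  ≡⟨ +-assoc T Z X ⟨
  T + Z + X    ≡⟨ cong (_+ X) (+-comm T Z) ⟩
  Z + T + X    ∎)
  where open ≤-Reasoning

tree+path-erdősGallai : ∀ n → 6 ≤ n → (a b : Fin n → ℕ) → IsTreeDegSeq n a → IsPathDegSeq n b →
  ∀ s → 2 ≤ s → s ≤ n →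
  sumFin n (λ k → if< (toℕ k) s (a k + b k) 0)
    ≤ s * (s ∸ 1) + sumFin n (λ k → if< (toℕ k) s 0 (s ⊓ (a k + b k)))
tree+path-erdősGallai n _ _ _ _ _ 1 (s≤s ()) _
tree+path-erdősGallai n 6≤n a b (a≥1 , Σa) path@((b≥1 , _) , _) 2 _ 2≤n =
  ≤-budget
    (sumFin-head+tail≤ n 2 2 3 (λ k → a k + b k) (λ k → 2 ⊓ (a k + b k)) a 2≤n
      (λ k → column≤2+ (IsPathDegSeq⇒≤2 n path k)) (λ k → 3≤2-capped-column (a≥1 k) (b≥1 k)))
    (budget2 n (sumFin n a) 6≤n Σa)
tree+path-erdősGallai n 6≤n a b (a≥1 , Σa) path@((b≥1 , _) , ones) s@(suc (suc (suc _))) _ s≤n =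
  ≤-budget
    (sumFin-head+tail≤ n s 2 4 (λ k → a k + b k) (λ k → s ⊓ (a k + b k)) w s≤n
      (λ k → ≤-trans (column≤2+ (IsPathDegSeq⇒≤2 n path k)) (+-monoʳ-≤ 2 (m≤m+n (a k) _)))
      (λ k → 4≤capped-column (s≤s (s≤s (s≤s z≤n))) (a≥1 k) (b≥1 k)))
    (≤-trans (≤-reflexive (cong (s * 2 +_) Σw≡2n)) (budget≥3 s n (s≤s (s≤s (s≤s z≤n))) s≤n 6≤n))
  where
  w : Fin n → ℕ
  w k = a k + isOne (b k)
  Σw≡2n : sumFin n w ≡ 2 * n
  Σw≡2n = trans (sumFin-+ n a _) (trans (cong (sumFin n a +_) (trans (sym (countOnes-isOne n b)) ones)) Σa)

mainTheorem6 : (n : ℕ) → 6 ≤ n → (D : Fin 2 → Fin n → ℕ) →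
    IsTreeDegMatrix 2 n D → IsPathDegSeq n (D (suc zero)) →
    (σ : Fin n ↔ Fin n) →
    NonIncreasing (λ k → D zero (Inverse.to σ k) + D (suc zero) (Inverse.to σ k)) →
    (s : ℕ) → 2 ≤ s → s ≤ n →
    sumFin n (λ k → if< (toℕ k) s (D zero (Inverse.to σ k) + D (suc zero) (Inverse.to σ k)) 0)
      ≤ s * (s ∸ 1)
        + sumFin n (λ k → if< (toℕ k) s 0 (s ⊓ (D zero (Inverse.to σ k) + D (suc zero) (Inverse.to σ k))))
mainTheorem6 n 6≤n D tree path σ _ =
  tree+path-erdősGallai n 6≤n (λ k → D zero (Inverse.to σ k)) (λ k → D (suc zero) (Inverse.to σ k))
    (IsTreeDegSeq-permute n σ (tree zero)) (IsPathDegSeq-permute n σ path)
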